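{- Let $m$ be a positive integer, let $S\subseteq\mathbb R_{>0}^m$ be an intervallic subspace, and let $F$ be a finite set of nonzero linear functions $f:\mathbb R_{>0}^m\to\mathbb R_{>0}$ with nonnegative integer coefficients. Then there exist $m'\ge m$ and an intervallic subspace $S'\subseteq\mathbb R_{>0}^{m'}$ such that the projection $\pi_{m',m}$ restricts to a linear isomorphism $S'\to S$, and for every $f\in F$ there exists an index $0\le i<m'$ such that $v_i=f(\pi_{m',m}(v))$ for all $v\in S'$.
   Context: Coordinates on $\mathbb R^k$ are indexed $v=(v_0,\dots,v_{k-1})$. For $k'\ge k$, $\pi_{k',k}:\mathbb R^{k'}\to\mathbb R^k$ is the projection to the first $k$ coordinates. A tuple of integers $(a',b',a,b)$ is admissible if $a<b$, $a'<b'$, $a'<a$ and $b'<b$. A subset $S\subseteq\mathbb R_{>0}^k$ is intervallic if there is a finite set $I$ of admissible tuples with entries in $\{0,\dots,k\}$ such that $S$ is exactly the set of $v\in\mathbb R_{>0}^k$ satisfying $\sum_{a\le j<b}v_j=\sum_{a'\le j<b'}v_j$ for all $(a',b',a,b)\in I$. -}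

module Defs where

open import Level using (Level; _⊔_) renaming (suc to lsuc)
open import Data.Nat using (ℕ; zero; suc; _<_; _≤_; _∸_)
open import Data.Fin using (Fin; toℕ; fromℕ<; inject≤)
import Data.Fin as Fin
import Data.Nat
import Relation.Nullary
open import Data.Product using (Σ; ∃; _×_; _,_)
open import Data.List using (List)
open import Data.List.Relation.Unary.All using (All)
open import Data.Empty using (⊥)
open import Relation.Nullary using (¬_)
open import Relation.Binary.Core using (Rel)
open import Relation.Binary.Structures using (IsStrictTotalOrder)
open import Relation.Binary.PropositionalEquality using (_≢_)
open import Algebra.Bundles using (CommutativeRing)
open import Function.Bundles using (_⇔_)

-- An ordered field (the paper works over ℝ, which is an instance).
record OrderedField (c ℓ : Level) : Set (lsuc (c ⊔ ℓ)) where
  field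
    commutativeRing : CommutativeRing c ℓ
  open CommutativeRing commutativeRing public
  field
    _<ᶠ_                : Rel Carrier ℓ
    <-isStrictTotalOrder : IsStrictTotalOrder _≈_ _<ᶠ_
    +-mono-<            : ∀ {x y} z → x <ᶠ y → (x + z) <ᶠ (y + z)
    *-pos               : ∀ {x y} → 0# <ᶠ x → 0# <ᶠ y → 0# <ᶠ (x * y)
    1≉0                 : ¬ (1# ≈ 0#)
    inverse             : ∀ x → ¬ (x ≈ 0#) → ∃ λ y → (x * y) ≈ 1#

module _ {c ℓ : Level} (K : OrderedField c ℓ) where
  open OrderedField K

  Vect : ℕ → Set c
  Vect k = Fin k → Carrier

  Positive : ∀ {k} → Vect k → Set ℓ
  Positive v = ∀ i → 0# <ᶠ v i

  ext : ∀ {k} → Vect k → ℕ → Carrier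
  ext {k} v j with j Data.Nat.<? k
  ... | Relation.Nullary.yes p = v (fromℕ< p)
  ... | Relation.Nullary.no _  = 0#

  sumFrom : ∀ {k} → Vect k → ℕ → ℕ → Carrier
  sumFrom v a zero    = 0#
  sumFrom v a (suc n) = ext v a + sumFrom v (suc a) n

  intervalSum : ∀ {k} → Vect k → ℕ → ℕ → Carrier
  intervalSum v a b = sumFrom v a (b ∸ a)

  record Admissible (k : ℕ) : Set where
    constructor adm
    field
      a' b' a b : Fin (suc k)
      a<b   : toℕ a < toℕ b
      a'<b' : toℕ a' < toℕ b'
      a'<a  : toℕ a' < toℕ a
      b'<b  : toℕ b' < toℕ b

  Satisfies : ∀ {k} → Admissible k → Vect k → Set ℓ
  Satisfies t v =
    intervalSum v (toℕ (Admissible.a t)) (toℕ (Admissible.b t))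
      ≈ intervalSum v (toℕ (Admissible.a' t)) (toℕ (Admissible.b' t))

  Intervallic : ∀ {k} → (Vect k → Set ℓ) → Set (c ⊔ ℓ)
  Intervallic {k} S =
    Σ (List (Admissible k)) λ I →
      ∀ v → S v ⇔ (Positive v × All (λ t → Satisfies t v) I)

  _≋_ : ∀ {k} → Vect k → Vect k → Set ℓ
  v ≋ w = ∀ i → v i ≈ w i

  proj : ∀ {k k'} → k ≤ k' → Vect k' → Vect k
  proj k≤k' v i = v (inject≤ i k≤k')

  natScale : ℕ → Carrier → Carrier
  natScale zero    x = 0#
  natScale (suc n) x = x + natScale n x

  evalLin : ∀ {k} → (Fin k → ℕ) → Vect k → Carrier
  evalLin {zero}  c v = 0#
  evalLin {suc k} c v = natScale (c Fin.zero) (v Fin.zero)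
                          + evalLin (λ i → c (Fin.suc i)) (λ i → v (Fin.suc i))

  NonzeroCoeffs : ∀ {k} → (Fin k → ℕ) → Set
  NonzeroCoeffs c = ∃ λ j → c j ≢ 0

  ProjIso : ∀ {k k'} → k ≤ k' → (Vect k' → Set ℓ) → (Vect k → Set ℓ) → Set (c ⊔ ℓ)
  ProjIso le S' S =
      (∀ v → S' v → S (proj le v))
    × (∀ v w → S' v → S' w → proj le v ≋ proj le w → v ≋ w)
    × (∀ u → S u → ∃ λ v → S' v × (proj le v ≋ u))

-- The basic move ("adjoining an interval sum") takes an intervallic S ⊆ K^k and
-- an interval [a, a+n) ⊆ [0, k) with n ≥ 1, and adds the single admissible tuple
-- (a, a+n, k, k+1), i.e. the equation v_k = v_a + … + v_(a+n-1).  The projection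
-- to K^k is a bijection onto S, since the new coordinate is determined by the
-- old ones, and it is positive because the interval is nonempty.
--
-- A linear form with coefficients c is written as a sum Σ_{j ∈ L} v_j over the
-- multiset L of indices in which j occurs c_j times.  Such a sum becomes a
-- coordinate in two rounds of adjoining: first one copy v_j (interval [j, j+1))
-- for every j ∈ L, placed contiguously, then one coordinate summing the block of
-- copies.  Extensions compose and a realised coordinate survives further
-- extensions, so treating the forms of F one after another proves the lemma.
module Submission where

open import Level using (Level; _⊔_) renaming (suc to lsuc)
open import Data.Nat using (ℕ; zero; suc; _+_; _∸_; _≤_; _<_; z≤n; s≤s; _<?_)
import Data.Nat.Properties as ℕ
open import Data.Nat.Properties
  using (≤-refl; ≤-reflexive; ≤-trans; <-≤-trans; <⇒≤; n≤1+n; +-suc; m<m+n; m+n∸m≡n; m+n∸n≡m; m+[n∸m]≡n; m≤n⇒m<n∨m≡n; <-irrefl; <-trans)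
open import Data.Fin using (Fin; toℕ; fromℕ<; inject≤)
import Data.Fin as Fin
open import Data.Fin.Properties using (toℕ-fromℕ; toℕ-injective; toℕ-fromℕ<; toℕ-inject≤; toℕ<n; toℕ≤pred[n])
open import Data.Product using (Σ; ∃; _×_; _,_; proj₁; proj₂)
open import Data.Sum using (inj₁; inj₂)
open import Data.List using (List; []; _∷_; length; map; replicate; _++_)
open import Data.List.Relation.Unary.All using (All; []; _∷_)
import Data.List.Relation.Unary.All as All
open import Data.List.Relation.Unary.All.Properties using (map⁺; map⁻; ++⁺; replicate⁺)
open import Data.List.Properties using (length-map; length-++-≤ʳ)
open import Data.Empty using (⊥-elim)
open import Relation.Nullary using (yes; no; ¬_)
open import Relation.Binary.PropositionalEquality as ≡ using (_≡_; refl; cong; cong₂)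
open import Relation.Binary.Structures using (IsStrictTotalOrder)
open import Function.Base using (id; _∘_)
open import Function.Bundles using (_⇔_; mk⇔; Equivalence)
open import Defs

module Development {c ℓ : Level} (K : OrderedField c ℓ) where
  open OrderedField K renaming (_+_ to _⊕_; refl to ≈-refl; sym to ≈-sym; trans to ≈-trans)
  open IsStrictTotalOrder <-isStrictTotalOrder using (<-respʳ-≈) renaming (trans to <ᶠ-trans)

  ext-< : ∀ {k} (v : Vect K k) {j} (j<k : j < k) → ext K v j ≡ v (fromℕ< j<k)
  ext-< {k} v {j} j<k with j <? k
  ... | yes _   = refl
  ... | no j≮k = ⊥-elim (j≮k j<k)

  ext-toℕ : ∀ {k} (v : Vect K k) (i : Fin k) → ext K v (toℕ i) ≡ v i
  ext-toℕ v i = ≡.trans (ext-< v (toℕ<n i)) (cong v (toℕ-injective (toℕ-fromℕ< (toℕ<n i))))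

  ext-cong : ∀ {k} {v w : Vect K k} → _≋_ K v w → ∀ j → ext K v j ≈ ext K w j
  ext-cong {k} v≋w j with j <? k
  ... | yes j<k = v≋w (fromℕ< j<k)
  ... | no _    = ≈-refl

  ext-proj : ∀ {k k'} (le : k ≤ k') (v : Vect K k') {j} → j < k → ext K (proj K le v) j ≡ ext K v j
  ext-proj le v {j} j<k = begin
      ext K (proj K le v) j         ≡⟨ ext-< (proj K le v) j<k ⟩
      v (inject≤ i le)              ≡⟨ ext-toℕ v (inject≤ i le) ⟨
      ext K v (toℕ (inject≤ i le))  ≡⟨ cong (ext K v) (toℕ-inject≤ i le) ⟩
      ext K v (toℕ i)               ≡⟨ cong (ext K v) (toℕ-fromℕ< j<k) ⟩
      ext K v j                     ∎
    where open ≡.≡-Reasoning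
          i = fromℕ< j<k

  ext-≥ : ∀ {k} (v : Vect K k) {j} → ¬ (j < k) → ext K v j ≡ 0#
  ext-≥ {k} v {j} j≮k with j <? k
  ... | yes j<k = ⊥-elim (j≮k j<k)
  ... | no _    = refl

  ext-tail : ∀ {k} (v : Vect K (suc k)) j → ext K v (suc j) ≡ ext K (v ∘ Fin.suc) j
  ext-tail {k} v j with j <? k
  ... | yes j<k = ext-< v (s≤s j<k)
  ... | no j≮k  = ext-≥ v λ { (s≤s j<k) → j≮k j<k }

  ext-agree⇒≋ : ∀ {k} {v w : Vect K k} → (∀ j → j < k → ext K v j ≈ ext K w j) → _≋_ K v w
  ext-agree⇒≋ {v = v} {w} agree i =
    ≡.subst₂ _≈_ (ext-toℕ v i) (ext-toℕ w i) (agree (toℕ i) (toℕ<n i))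

  ext-pos : ∀ {k} {v : Vect K k} → Positive K v → ∀ {j} → j < k → 0# <ᶠ ext K v j
  ext-pos {v = v} pos j<k = ≡.subst (0# <ᶠ_) (≡.sym (ext-< v j<k)) (pos (fromℕ< j<k))

  snoc : ∀ {k} → Vect K k → Carrier → Vect K (suc k)
  snoc {k} v x i with toℕ i <? k
  ... | yes i<k = v (fromℕ< i<k)
  ... | no _    = x

  snoc-proj : ∀ {k} (le : k ≤ suc k) (v : Vect K k) x → _≋_ K (proj K le (snoc v x)) v
  snoc-proj {k} le v x i with toℕ (inject≤ i le) <? k
  ... | yes i<k = reflexive (cong v (toℕ-injective (≡.trans (toℕ-fromℕ< i<k) (toℕ-inject≤ i le))))
  ... | no i≮k  = ⊥-elim (i≮k (≡.subst (_< k) (≡.sym (toℕ-inject≤ i le)) (toℕ<n i)))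

  snoc-last : ∀ {k} (v : Vect K k) x → ext K (snoc v x) k ≡ x
  snoc-last {k} v x with k <? suc k
  ... | no k≮1+k = ⊥-elim (k≮1+k ≤-refl)
  ... | yes k<1+k with toℕ (fromℕ< k<1+k) <? k
  ...   | yes k<k = ⊥-elim (<-irrefl (toℕ-fromℕ< k<1+k) k<k)
  ...   | no _    = refl

  snoc-pos : ∀ {k} {v : Vect K k} {x} → Positive K v → 0# <ᶠ x → Positive K (snoc v x)
  snoc-pos {k} pos 0<x i with toℕ i <? k
  ... | yes i<k = pos (fromℕ< i<k)
  ... | no _    = 0<x

  start<end : ∀ a {n B} → a + suc n ≤ B → a < B
  start<end a a+n≤B = <-≤-trans (m<m+n a (s≤s z≤n)) a+n≤B

  rest≤ : ∀ a {n B} → a + suc n ≤ B → suc a + n ≤ B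
  rest≤ a {n} {B} = ≡.subst (_≤ B) (+-suc a n)

  sumFrom-cong : ∀ {k k'} {v : Vect K k} {w : Vect K k'} {B} →
    (∀ j → j < B → ext K v j ≈ ext K w j) → ∀ a n → a + n ≤ B → sumFrom K v a n ≈ sumFrom K w a n
  sumFrom-cong agree a zero    _       = ≈-refl
  sumFrom-cong agree a (suc n) a+n≤B =
    +-cong (agree a (start<end a a+n≤B))
           (sumFrom-cong agree (suc a) n (rest≤ a a+n≤B))

  +-pos : ∀ {x y} → 0# <ᶠ x → 0# <ᶠ y → 0# <ᶠ (x ⊕ y)
  +-pos {x} {y} 0<x 0<y = <ᶠ-trans (<-respʳ-≈ (≈-sym (+-identityˡ y)) 0<y) (+-mono-< y 0<x)

  sumFrom-pos : ∀ {k} {v : Vect K k} → Positive K v → ∀ a n → 1 ≤ n → a + n ≤ k → 0# <ᶠ sumFrom K v a n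
  sumFrom-pos pos a (suc zero)    _ a+1≤k =
    <-respʳ-≈ (≈-sym (+-identityʳ _)) (ext-pos pos (start<end a a+1≤k))
  sumFrom-pos pos a (suc (suc n)) _ a+n≤k =
    +-pos (ext-pos pos (start<end a a+n≤k))
          (sumFrom-pos pos (suc a) (suc n) (s≤s z≤n) (rest≤ a a+n≤k))

  intervalSum-proj : ∀ {k k'} (le : k ≤ k') (v : Vect K k') {a b} → a ≤ b → b ≤ k →
    intervalSum K (proj K le v) a b ≈ intervalSum K v a b
  intervalSum-proj le v {a} {b} a≤b b≤k =
    sumFrom-cong (λ j j<k → reflexive (ext-proj le v j<k)) a (b ∸ a)
                 (≡.subst (_≤ _) (≡.sym (m+[n∸m]≡n a≤b)) b≤k)

  intervalSum-≋ : ∀ {k} {v w : Vect K k} → _≋_ K v w → ∀ a b → intervalSum K v a b ≈ intervalSum K w a b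
  intervalSum-≋ v≋w a b = sumFrom-cong (λ j _ → ext-cong v≋w j) a (b ∸ a) ≤-refl

  intervallic-resp : ∀ {k} {S : Vect K k → Set ℓ} → Intervallic K S → ∀ {v w} → _≋_ K v w → S v → S w
  intervallic-resp (I , iff) {v} {w} v≋w v∈S with Equivalence.to (iff v) v∈S
  ... | pos , sat = Equivalence.from (iff w) (pos′ , All.map (λ {t} → sat′ t) sat)
    where
      pos′ : Positive K w
      pos′ i = <-respʳ-≈ (v≋w i) (pos i)
      sat′ : ∀ t → Satisfies K t v → Satisfies K t w
      sat′ (adm a' b' a b _ _ _ _) eq =
        ≈-trans (≈-sym (intervalSum-≋ v≋w (toℕ a) (toℕ b))) (≈-trans eq (intervalSum-≋ v≋w (toℕ a') (toℕ b')))

  admissible : ∀ {k} a' b' a b → a < b → a' < b' → a' < a → b' < b → b ≤ k → Admissible K k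
  admissible {k} a' b' a b a<b a'<b' a'<a b'<b b≤k =
    adm (entry a'≤b) (entry b'≤b) (entry a≤b) (entry ≤-refl)
        (entry-< a≤b ≤-refl a<b) (entry-< a'≤b b'≤b a'<b') (entry-< a'≤b a≤b a'<a) (entry-< b'≤b ≤-refl b'<b)
    where
      a≤b = <⇒≤ a<b
      b'≤b = <⇒≤ b'<b
      a'≤b = <⇒≤ (<-trans a'<a a<b)
      entry : ∀ {x} → x ≤ b → Fin (suc k)
      entry x≤b = fromℕ< (s≤s (≤-trans x≤b b≤k))
      entry-< : ∀ {x y} (x≤b : x ≤ b) (y≤b : y ≤ b) → x < y → toℕ (entry x≤b) < toℕ (entry y≤b)
      entry-< _ _ x<y = ≡.subst₂ _<_ (≡.sym (toℕ-fromℕ< _)) (≡.sym (toℕ-fromℕ< _)) x<y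

  admissible-sat : ∀ {k} a' b' a b a<b a'<b' a'<a b'<b b≤k (v : Vect K k) →
    Satisfies K (admissible a' b' a b a<b a'<b' a'<a b'<b b≤k) v ≡
      (intervalSum K v a b ≈ intervalSum K v a' b')
  admissible-sat {k} a' b' a b _ _ _ _ _ v =
    cong₂ _≈_ (cong₂ (intervalSum K v) (toℕ-fromℕ< {m = a} {n = suc k} _) (toℕ-fromℕ< {m = b} {n = suc k} _))
                (cong₂ (intervalSum K v) (toℕ-fromℕ< {m = a'} {n = suc k} _) (toℕ-fromℕ< {m = b'} {n = suc k} _))

  liftTuple : ∀ {k k'} → k ≤ k' → Admissible K k → Admissible K k'
  liftTuple le (adm a' b' a b a<b a'<b' a'<a b'<b) =
    admissible (toℕ a') (toℕ b') (toℕ a) (toℕ b) a<b a'<b' a'<a b'<b (≤-trans (toℕ≤pred[n] b) le)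

  liftTuple-sat : ∀ {k k'} (le : k ≤ k') (t : Admissible K k) (v : Vect K k') →
    Satisfies K (liftTuple le t) v ⇔ Satisfies K t (proj K le v)
  liftTuple-sat le t@(adm a' b' a b a<b a'<b' a'<a b'<b) v
    rewrite admissible-sat (toℕ a') (toℕ b') (toℕ a) (toℕ b) a<b a'<b' a'<a b'<b (≤-trans (toℕ≤pred[n] b) le) v =
    mk⇔ (λ eq → ≈-trans lhs (≈-trans eq (≈-sym rhs)))
        (λ eq → ≈-trans (≈-sym lhs) (≈-trans eq rhs))
    where
      b≤k = toℕ≤pred[n] b
      lhs = intervalSum-proj le v (<⇒≤ a<b) b≤k
      rhs = intervalSum-proj le v (<⇒≤ a'<b') (≤-trans (<⇒≤ b'<b) b≤k)

  record Extension {k} (S : Vect K k → Set ℓ) : Set (c ⊔ lsuc ℓ) where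
    field
      dim         : ℕ
      dim≥        : k ≤ dim
      space       : Vect K dim → Set ℓ
      intervallic : Intervallic K space
      projIso     : ProjIso K dim≥ space S

    proj∈ : ∀ {v} → space v → S (proj K dim≥ v)
    proj∈ = proj₁ projIso _

    proj-injective : ∀ v w → space v → space w → _≋_ K (proj K dim≥ v) (proj K dim≥ w) → _≋_ K v w
    proj-injective = proj₁ (proj₂ projIso)

    proj-onto : ∀ u → S u → ∃ λ v → space v × _≋_ K (proj K dim≥ v) u
    proj-onto = proj₂ (proj₂ projIso)

  open Extension

  extension-refl : ∀ {k} {S : Vect K k → Set ℓ} → Intervallic K S → Extension S
  extension-refl {k} {S} IS = record
    { dim = k ; dim≥ = ≤-refl ; space = S ; intervallic = IS
    ; projIso = (λ v v∈S → intervallic-resp IS (≈-sym ∘ proj-refl v) v∈S)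
              , (λ v w _ _ v≈w i → ≡.subst₂ _≈_ (proj-refl-≡ v i) (proj-refl-≡ w i) (v≈w i))
              , (λ u u∈S → u , u∈S , proj-refl u) }
    where
      proj-refl-≡ : ∀ (v : Vect K k) i → proj K ≤-refl v i ≡ v i
      proj-refl-≡ v i = cong v (toℕ-injective (toℕ-inject≤ i ≤-refl))
      proj-refl : ∀ (v : Vect K k) → _≋_ K (proj K ≤-refl v) v
      proj-refl v i = reflexive (proj-refl-≡ v i)

  proj-proj : ∀ {k₁ k₂ k₃} (le₁ : k₁ ≤ k₂) (le₂ : k₂ ≤ k₃) (v : Vect K k₃) i →
    proj K le₁ (proj K le₂ v) i ≡ proj K (≤-trans le₁ le₂) v i
  proj-proj le₁ le₂ v i = cong v (toℕ-injective (begin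
      toℕ (inject≤ (inject≤ i le₁) le₂) ≡⟨ toℕ-inject≤ _ le₂ ⟩
      toℕ (inject≤ i le₁)               ≡⟨ toℕ-inject≤ i le₁ ⟩
      toℕ i                             ≡⟨ toℕ-inject≤ i _ ⟨
      toℕ (inject≤ i (≤-trans le₁ le₂)) ∎))
    where open ≡.≡-Reasoning

  extension-trans : ∀ {k} {S : Vect K k → Set ℓ} → Intervallic K S →
    (E : Extension S) → Extension (space E) → Extension S
  extension-trans {S = S} IS E E′ = record
    { dim = dim E′ ; dim≥ = le ; space = space E′ ; intervallic = intervallic E′
    ; projIso = into , injective , onto }
    where
      le = ≤-trans (dim≥ E) (dim≥ E′)
      two-steps : ∀ v → _≋_ K (proj K (dim≥ E) (proj K (dim≥ E′) v)) (proj K le v)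
      two-steps v i = reflexive (proj-proj (dim≥ E) (dim≥ E′) v i)
      into : ∀ v → space E′ v → S (proj K le v)
      into v v∈ = intervallic-resp IS (two-steps v) (proj∈ E (proj∈ E′ v∈))
      injective : ∀ v w → space E′ v → space E′ w → _≋_ K (proj K le v) (proj K le w) → _≋_ K v w
      injective v w v∈ w∈ v≈w = proj-injective E′ v w v∈ w∈
        (proj-injective E _ _ (proj∈ E′ v∈) (proj∈ E′ w∈)
          (λ i → ≈-trans (two-steps v i) (≈-trans (v≈w i) (≈-sym (two-steps w i)))))
      onto : ∀ u → S u → ∃ λ v → space E′ v × _≋_ K (proj K le v) u
      onto u u∈ with proj-onto E u u∈
      ... | u′ , u′∈ , u′↦u with proj-onto E′ u′ u′∈
      ... | v , v∈ , v↦u′ = v , v∈ , λ i → ≈-trans (≈-sym (two-steps v i)) (≈-trans (v↦u′ _) (u′↦u i))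

  module Adjoin {k} {S : Vect K k → Set ℓ} (IS : Intervallic K S)
                (a n : ℕ) (n≥1 : 1 ≤ n) (a+n≤k : a + n ≤ k) where

    le : k ≤ suc k
    le = n≤1+n k

    a<a+n : a < a + n
    a<a+n = m<m+n a n≥1

    newTuple : Admissible K (suc k)
    newTuple = admissible a (a + n) k (suc k) ≤-refl a<a+n (<-≤-trans a<a+n a+n≤k) (s≤s a+n≤k) ≤-refl

    newTuple-sat : ∀ v → Satisfies K newTuple v ⇔ (ext K v k ≈ sumFrom K v a n)
    newTuple-sat v
      rewrite admissible-sat a (a + n) k (suc k) ≤-refl a<a+n (<-≤-trans a<a+n a+n≤k) (s≤s a+n≤k) ≤-refl v
            | m+n∸n≡m 1 k | m+n∸m≡n a n =
      mk⇔ (≈-trans (≈-sym (+-identityʳ _))) (≈-trans (+-identityʳ _))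

    space⁺ : Vect K (suc k) → Set ℓ
    space⁺ v = Positive K v × All (λ t → Satisfies K t v) (newTuple ∷ map (liftTuple le) (proj₁ IS))

    value : ∀ {v} → space⁺ v → ext K v k ≈ sumFrom K v a n
    value {v} (_ , new ∷ _) = Equivalence.to (newTuple-sat v) new

    into : ∀ v → space⁺ v → S (proj K le v)
    into v (pos , _ ∷ lifted) = Equivalence.from (proj₂ IS (proj K le v))
      ( (λ i → pos (inject≤ i le))
      , All.map (λ {t} → Equivalence.to (liftTuple-sat le t v)) (map⁻ lifted))

    -- A point of space⁺ is determined by its first k coordinates, the last
    -- one being a range sum of them.
    injective : ∀ v w → space⁺ v → space⁺ w → _≋_ K (proj K le v) (proj K le w) → _≋_ K v w
    injective v w v∈ w∈ v≈w = ext-agree⇒≋ agree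
      where
        below : ∀ j → j < k → ext K v j ≈ ext K w j
        below j j<k = ≈-trans (reflexive (≡.sym (ext-proj le v j<k)))
                        (≈-trans (ext-cong v≈w j) (reflexive (ext-proj le w j<k)))
        agree : ∀ j → j < suc k → ext K v j ≈ ext K w j
        agree j (s≤s j≤k) with m≤n⇒m<n∨m≡n j≤k
        ... | inj₁ j<k  = below j j<k
        ... | inj₂ refl = ≈-trans (value v∈) (≈-trans (sumFrom-cong below a n a+n≤k) (≈-sym (value w∈)))

    -- Every u ∈ S lifts to (u, Σ_{a ≤ j < a+n} u_j), which is positive since
    -- the range is nonempty.
    onto : ∀ u → S u → ∃ λ v → space⁺ v × _≋_ K (proj K le v) u
    onto u u∈ = v , (snoc-pos pos 0<x , new ∷ map⁺ lifted) , snoc-proj le u x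
      where
        pos = proj₁ (Equivalence.to (proj₂ IS u) u∈)
        x = sumFrom K u a n
        0<x = sumFrom-pos pos a n n≥1 a+n≤k
        v = snoc u x
        old : ∀ j → j < k → ext K u j ≈ ext K v j
        old j j<k = ≈-trans (ext-cong (≈-sym ∘ snoc-proj le u x) j) (reflexive (ext-proj le v j<k))
        new : Satisfies K newTuple v
        new = Equivalence.from (newTuple-sat v)
                (≈-trans (reflexive (snoc-last u x)) (sumFrom-cong old a n a+n≤k))
        lifted : All (λ t → Satisfies K (liftTuple le t) v) (proj₁ IS)
        lifted = All.map (λ {t} → Equivalence.from (liftTuple-sat le t v))
                   (proj₂ (Equivalence.to (proj₂ IS (proj K le v))
                            (intervallic-resp IS (≈-sym ∘ snoc-proj le u x) u∈)))

    extension : Extension S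
    extension = record
      { dim = suc k ; dim≥ = le ; space = space⁺
      ; intervallic = _ , λ v → mk⇔ id id
      ; projIso = into , injective , onto }

    value-after : (E : Extension space⁺) → ∀ {v} → space E v → ext K v k ≈ sumFrom K v a n
    value-after E {v} v∈ =
      ≈-trans (reflexive (≡.sym (ext-proj (dim≥ E) v ≤-refl)))
        (≈-trans (value (proj∈ E v∈))
          (sumFrom-cong (λ j j<k → reflexive (ext-proj (dim≥ E) v j<k)) a n (≤-trans a+n≤k le)))

  sumOver : List ℕ → (ℕ → Carrier) → Carrier
  sumOver []      g = 0#
  sumOver (j ∷ L) g = g j ⊕ sumOver L g

  sumOver-proj : ∀ {k k'} (le : k ≤ k') (v : Vect K k') {L} → All (_< k) L →
    sumOver L (ext K (proj K le v)) ≈ sumOver L (ext K v)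
  sumOver-proj le v []            = ≈-refl
  sumOver-proj le v (j<k ∷ L<k) = +-cong (reflexive (ext-proj le v j<k)) (sumOver-proj le v L<k)

  Realises : ∀ {k} → (Vect K k → Set ℓ) → List ℕ → Set (c ⊔ ℓ)
  Realises {k} S L = ∃ λ (i : Fin k) → ∀ v → S v → v i ≈ sumOver L (ext K v)

  realises-extension : ∀ {k} {S : Vect K k → Set ℓ} {L} → All (_< k) L →
    (E : Extension S) → Realises S L → Realises (space E) L
  realises-extension L<k E (i , realised) =
    inject≤ i (dim≥ E) , λ v v∈ → ≈-trans (realised _ (proj∈ E v∈)) (sumOver-proj (dim≥ E) v L<k)

  copies : ∀ {k} {S : Vect K k → Set ℓ} → Intervallic K S → ∀ L → All (_< k) L →
    Σ (Extension S) λ E → k + length L ≤ dim E ×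
      ∀ v → space E v → sumFrom K v k (length L) ≈ sumOver L (ext K v)
  copies {k} IS [] [] = extension-refl IS , ≤-reflexive (ℕ.+-identityʳ k) , λ _ _ → ≈-refl
  copies {k} IS (j ∷ L) (j<k ∷ L<k) =
    let E , bound , copied = copies (intervallic Copy.extension) L (All.map (λ p → <-≤-trans p Copy.le) L<k)
    in extension-trans IS Copy.extension E , ≡.subst (_≤ dim E) (≡.sym (+-suc k _)) bound ,
       λ v v∈ → +-cong (≈-trans (Copy.value-after E v∈) (+-identityʳ _)) (copied v v∈)
    where module Copy = Adjoin IS j 1 ≤-refl (≡.subst (_≤ k) (ℕ.+-comm 1 j) j<k)

  realiseSum : ∀ {k} {S : Vect K k → Set ℓ} → Intervallic K S → ∀ L → 1 ≤ length L → All (_< k) L →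
    Σ (Extension S) λ E → Realises (space E) L
  realiseSum {k} IS L nonempty L<k with copies IS L L<k
  ... | E , bound , copied =
    extension-trans IS E Total.extension , Fin.fromℕ (dim E) , λ v v∈ → begin
      v (Fin.fromℕ (dim E))                        ≡⟨ ext-toℕ v _ ⟨
      ext K v (toℕ (Fin.fromℕ (dim E)))            ≡⟨ cong (ext K v) (toℕ-fromℕ (dim E)) ⟩
      ext K v (dim E)                              ≈⟨ Total.value v∈ ⟩
      sumFrom K v k (length L)                     ≈⟨ sumFrom-cong (below v) k (length L) bound ⟨
      sumFrom K (proj K Total.le v) k (length L)   ≈⟨ copied _ (Total.into v v∈) ⟩
      sumOver L (ext K (proj K Total.le v))        ≈⟨ sumOver-proj Total.le v (All.map (λ p → <-≤-trans p (dim≥ E)) L<k) ⟩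
      sumOver L (ext K v)                          ∎
    where
      open import Relation.Binary.Reasoning.Setoid setoid
      module Total = Adjoin (intervallic E) k (length L) nonempty bound
      below : ∀ v j → j < dim E → ext K (proj K Total.le v) j ≈ ext K v j
      below v j j<d = reflexive (ext-proj Total.le v j<d)

  indices : ∀ {k} → (Fin k → ℕ) → List ℕ
  indices {zero}  c = []
  indices {suc k} c = replicate (c Fin.zero) 0 ++ map suc (indices (c ∘ Fin.suc))

  indices-< : ∀ {k} (c : Fin k → ℕ) → All (_< k) (indices c)
  indices-< {zero}  c = []
  indices-< {suc k} c = ++⁺ (replicate⁺ (c Fin.zero) (s≤s z≤n))
                            (map⁺ (All.map s≤s (indices-< (c ∘ Fin.suc))))

  indices-nonempty : ∀ {k} (c : Fin k → ℕ) → NonzeroCoeffs K c → 1 ≤ length (indices c)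
  indices-nonempty {suc k} c (Fin.zero , c₀≢0) with c Fin.zero
  ... | zero  = ⊥-elim (c₀≢0 refl)
  ... | suc _ = s≤s z≤n
  indices-nonempty {suc k} c (Fin.suc j , cⱼ≢0) = ≤-trans
    (≡.subst (1 ≤_) (≡.sym (length-map suc (indices (c ∘ Fin.suc)))) (indices-nonempty (c ∘ Fin.suc) (j , cⱼ≢0)))
    (length-++-≤ʳ (map suc (indices (c ∘ Fin.suc))) {replicate (c Fin.zero) 0})

  sumOver-++ : ∀ xs ys g → sumOver (xs ++ ys) g ≈ sumOver xs g ⊕ sumOver ys g
  sumOver-++ []       ys g = ≈-sym (+-identityˡ _)
  sumOver-++ (x ∷ xs) ys g = ≈-trans (+-cong ≈-refl (sumOver-++ xs ys g)) (≈-sym (+-assoc _ _ _))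

  sumOver-replicate : ∀ n j g → sumOver (replicate n j) g ≡ natScale K n (g j)
  sumOver-replicate zero    j g = refl
  sumOver-replicate (suc n) j g = cong (g j ⊕_) (sumOver-replicate n j g)

  sumOver-map : ∀ (f : ℕ → ℕ) xs g → sumOver (map f xs) g ≡ sumOver xs (g ∘ f)
  sumOver-map f []       g = refl
  sumOver-map f (x ∷ xs) g = cong (g (f x) ⊕_) (sumOver-map f xs g)

  evalLin-indices : ∀ {k} (c : Fin k → ℕ) (w : Vect K k) → evalLin K c w ≈ sumOver (indices c) (ext K w)
  evalLin-indices {zero}  c w = ≈-refl
  evalLin-indices {suc k} c w = begin
    natScale K (c Fin.zero) (w Fin.zero) ⊕ evalLin K (c ∘ Fin.suc) (w ∘ Fin.suc)
      ≈⟨ +-cong ≈-refl (evalLin-indices (c ∘ Fin.suc) (w ∘ Fin.suc)) ⟩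
    natScale K (c Fin.zero) (w Fin.zero) ⊕ sumOver tail (ext K (w ∘ Fin.suc))
      ≡⟨ cong₂ _⊕_ (≡.sym (sumOver-replicate (c Fin.zero) 0 (ext K w)))
                   (≡.sym (≡.trans (sumOver-map suc tail (ext K w)) (sumOver-ext tail))) ⟩
    sumOver (replicate (c Fin.zero) 0) (ext K w) ⊕ sumOver (map suc tail) (ext K w)
      ≈⟨ sumOver-++ (replicate (c Fin.zero) 0) (map suc tail) (ext K w) ⟨
    sumOver (indices c) (ext K w) ∎
    where
      open import Relation.Binary.Reasoning.Setoid setoid
      tail = indices (c ∘ Fin.suc)
      sumOver-ext : ∀ L → sumOver L (ext K w ∘ suc) ≡ sumOver L (ext K (w ∘ Fin.suc))
      sumOver-ext []      = refl
      sumOver-ext (j ∷ L) = cong₂ _⊕_ (ext-tail w j) (sumOver-ext L)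

  realiseAll : ∀ {m} {S : Vect K m → Set ℓ} → Intervallic K S →
    ∀ F → All (NonzeroCoeffs K) F → Σ (Extension S) λ E → All (λ f → Realises (space E) (indices f)) F
  realiseAll IS [] [] = extension-refl IS , []
  realiseAll IS (f ∷ F) (f≢0 ∷ F≢0) =
    let E , realised = realiseAll IS F F≢0
        E′ , realised-f = realiseSum (intervallic E) (indices f) (indices-nonempty f f≢0) (indices-<-dim E f)
    in extension-trans IS E E′ ,
       realised-f ∷ All.map (λ {g} → realises-extension (indices-<-dim E g) E′) realised
    where
      indices-<-dim : ∀ (E : Extension _) g → All (_< dim E) (indices g)
      indices-<-dim E g = All.map (λ j<m → <-≤-trans j<m (dim≥ E)) (indices-< g)

  realises-form : ∀ {m} {S : Vect K m → Set ℓ} (E : Extension S) (f : Fin m → ℕ) →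
    Realises (space E) (indices f) →
    ∃ λ (i : Fin (dim E)) → ∀ v → space E v → v i ≈ evalLin K f (proj K (dim≥ E) v)
  realises-form E f (i , realised) = i , λ v v∈ → begin
    v i                                             ≈⟨ realised v v∈ ⟩
    sumOver (indices f) (ext K v)                   ≈⟨ sumOver-proj (dim≥ E) v (indices-< f) ⟨
    sumOver (indices f) (ext K (proj K (dim≥ E) v)) ≈⟨ evalLin-indices f (proj K (dim≥ E) v) ⟨
    evalLin K f (proj K (dim≥ E) v)                 ∎
    where open import Relation.Binary.Reasoning.Setoid setoid

-- Lemma 5.2.2: realise all forms of F in one extension of S.
lemma5p2p2 : {c ℓ : Level} (K : OrderedField c ℓ) (m : ℕ) → 1 ≤ m →
    (S : Vect K m → Set ℓ) → Intervallic K S →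
    (F : List (Fin m → ℕ)) → All (NonzeroCoeffs K) F →
    Σ ℕ λ m' → Σ (m ≤ m') λ le → Σ (Vect K m' → Set ℓ) λ S' →
    Intervallic K S' × ProjIso K le S' S ×
    All (λ f → ∃ λ (i : Fin m') → ∀ v → S' v →
    OrderedField._≈_ K (v i) (evalLin K f (proj K le v))) F
lemma5p2p2 K _ _ S IS F F≢0 =
  let E , realised = realiseAll IS F F≢0
  in dim E , dim≥ E , space E , intervallic E , projIso E , All.map (λ {f} → realises-form E f) realised
  where
    open Development K
    open Extension
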